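{- Let $w$ be a fully commutative permutation and let $d$ be a descent of $w$. If $w(d+2) < w(d)$, then $P(w) = P(w s_d)$.
   Context: A permutation is fully commutative iff it avoids $321$. $d$ is a descent of $w$ if $w(d)>w(d+1)$. $ws_d$ is obtained from $w$ by swapping the entries in positions $d,d+1$. $P(w)$ is the RSK insertion tableau of $w$. -}

module Defs where

open import Data.Nat using (ℕ; zero; suc; _≤ᵇ_)
open import Data.Bool using (if_then_else_)
open import Data.Fin using (Fin; toℕ; _<_)
open import Data.Fin.Permutation using (Permutation′; _⟨$⟩ʳ_; _∘ₚ_; transpose)
open import Data.List using (List; []; _∷_; foldl; map; allFin)
open import Data.Maybe using (Maybe; just; nothing)
open import Data.Product using (_×_; _,_; ∃-syntax)
open import Relation.Nullary using (¬_)
open import Relation.Binary.PropositionalEquality using (_≡_)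

-- A permutation of [n] (positions and values 0-indexed: Fin n).
-- Fully commutative = 321-avoiding: no positions i < j < k with w(i) > w(j) > w(k).
FullyCommutative : ∀ {n} → Permutation′ n → Set
FullyCommutative {n} w =
  ¬ (∃[ i ] ∃[ j ] ∃[ k ] (i < j × j < k × (w ⟨$⟩ʳ j) < (w ⟨$⟩ʳ i) × (w ⟨$⟩ʳ k) < (w ⟨$⟩ʳ j)))

Next : ∀ {n} → Fin n → Fin n → Set
Next i j = toℕ j ≡ suc (toℕ i)

-- w s_d : (w s_d)(i) = w(s_d(i)), i.e. swap the entries in positions d, d+1.
-- (Data.Fin.Permutation's _∘ₚ_ is diagrammatic: (π ∘ₚ ρ) ⟨$⟩ʳ i = ρ ⟨$⟩ʳ (π ⟨$⟩ʳ i).)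
rightMulTransposition : ∀ {n} → Permutation′ n → Fin n → Fin n → Permutation′ n
rightMulTransposition w d d' = transpose d d' ∘ₚ w

oneLine : ∀ {n} → Permutation′ n → List ℕ
oneLine {n} w = map (λ i → toℕ (w ⟨$⟩ʳ i)) (allFin n)

-- Young tableaux as lists of rows (each row increasing, listed top to bottom)
Tableau : Set
Tableau = List (List ℕ)

rowInsert : ℕ → List ℕ → Maybe ℕ × List ℕ
rowInsert x [] = nothing , (x ∷ [])
rowInsert x (y ∷ ys) =
  if suc x ≤ᵇ y then (just y , (x ∷ ys))
  else (let (b , ys') = rowInsert x ys in (b , (y ∷ ys')))

insert : ℕ → Tableau → Tableau
insert x [] = (x ∷ []) ∷ []
insert x (r ∷ rs) with rowInsert x r
... | nothing , r' = r' ∷ rs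
... | just y , r' = r' ∷ insert y rs

insertionTableau : List ℕ → Tableau
insertionTableau = foldl (λ T x → insert x T) []

P : ∀ {n} → Permutation′ n → Tableau
P w = insertionTableau (oneLine w)

-- Write a = w(d), b = w(d+1), c = w(d+2).  The hypotheses give b < a and c < a, and
-- 321-avoidance of w forces b ≤ c.  So the one-line words of w and w s_d differ by the
-- elementary Knuth move  a b c ↝ b a c  (b ≤ c < a), and Knuth moves preserve the insertion
-- tableau: inserting two Knuth-related words into a weakly increasing row produces the same
-- row and bumps out two words that are again Knuth equivalent, so induction over the rows of
-- the tableau applies.
module Submission where

open import Defs
open import Data.Bool using (false)
open import Data.Bool.Properties using (T-≡; ¬-not)
open import Data.Empty using (⊥)
import Data.Fin as Fin
open import Data.Fin using (Fin; toℕ; zero; suc)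
import Data.Fin.Permutation.Components as PC
open import Data.Fin.Permutation using (Permutation′; _⟨$⟩ʳ_)
open import Data.Fin.Properties using () renaming (suc-injective to suc-injectiveᶠ; _≟_ to _≟ᶠ_)
open import Data.List using (List; []; _∷_; _++_; foldl; fromMaybe; tabulate)
open import Data.List.Properties using (foldl-++; map-tabulate; tabulate-cong)
open import Data.List.Relation.Unary.All using (All; []; _∷_)
import Data.List.Relation.Unary.All as All
open import Data.List.Relation.Unary.AllPairs using (AllPairs; []; _∷_)
open import Data.Maybe using (Maybe; just; nothing)
open import Data.Nat using (ℕ; _≤_; _<_; _<ᵇ_)
open import Data.Nat.Properties
open import Data.Product using (_×_; _,_; proj₁; proj₂; ∃-syntax)
open import Data.Unit using (⊤; tt)
open import Function using (id; _∘_; Equivalence)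
open import Relation.Binary.Construct.Closure.Equivalence using (EqClosure; gfold)
open import Relation.Binary.Construct.Closure.ReflexiveTransitive using (ε; return)
open import Relation.Binary.Construct.Closure.Symmetric using (fwd; bwd)
open import Relation.Binary.PropositionalEquality
open import Relation.Nullary using (yes; no)
open import Relation.Nullary.Decidable using (dec-true; dec-false)

Sorted : List ℕ → Set
Sorted = AllPairs _≤_

<ᵇ-false : ∀ {m n} → n ≤ m → (m <ᵇ n) ≡ false
<ᵇ-false n≤m = ¬-not (λ m<ᵇn → <⇒≱ (<ᵇ⇒< _ _ (Equivalence.from T-≡ m<ᵇn)) n≤m)

rowInsert-bump : ∀ {t a} as → t < a → rowInsert t (a ∷ as) ≡ (just a , t ∷ as)
rowInsert-bump as t<a rewrite Equivalence.to T-≡ (<⇒<ᵇ t<a) = refl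

rowInsert-pass : ∀ {t a} as → a ≤ t →
  rowInsert t (a ∷ as) ≡ (proj₁ (rowInsert t as) , a ∷ proj₂ (rowInsert t as))
rowInsert-pass as a≤t rewrite <ᵇ-false a≤t = refl

rowInsert-lowerBound : ∀ {a t} r → All (a ≤_) r → a ≤ t → All (a ≤_) (proj₂ (rowInsert t r))
rowInsert-lowerBound         []       []         a≤t = a≤t ∷ []
rowInsert-lowerBound {t = t} (b ∷ bs) (a≤b ∷ a≤bs) a≤t with t <? b
... | yes t<b rewrite rowInsert-bump bs t<b = a≤t ∷ a≤bs
... | no  t≮b rewrite rowInsert-pass bs (≮⇒≥ t≮b) = a≤b ∷ rowInsert-lowerBound bs a≤bs a≤t

rowInsert-sorted : ∀ t {r} → Sorted r → Sorted (proj₂ (rowInsert t r))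
rowInsert-sorted t {[]}     []           = [] ∷ []
rowInsert-sorted t {b ∷ bs} (b≤bs ∷ bs↑) with t <? b
... | yes t<b rewrite rowInsert-bump bs t<b = All.map (≤-trans (<⇒≤ t<b)) b≤bs ∷ bs↑
... | no  t≮b rewrite rowInsert-pass bs (≮⇒≥ t≮b) =
  rowInsert-lowerBound bs b≤bs (≮⇒≥ t≮b) ∷ rowInsert-sorted t bs↑

rowInsert-bumped-bounds : ∀ {a c} t r → All (a ≤_) r → proj₁ (rowInsert t r) ≡ just c → a ≤ c × t < c
rowInsert-bumped-bounds t (b ∷ bs) (a≤b ∷ a≤bs) bumped with t <? b
... | yes t<b rewrite rowInsert-bump bs t<b with refl ← bumped = a≤b , t<b
... | no  t≮b rewrite rowInsert-pass bs (≮⇒≥ t≮b) = rowInsert-bumped-bounds t bs a≤bs bumped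

-- Inserting z and then a smaller y: y is stopped at the latest by z itself.
rowInsert-smaller-bumps : ∀ {y z} r → y < z →
  ∃[ c ] proj₁ (rowInsert y (proj₂ (rowInsert z r))) ≡ just c × c ≤ z
rowInsert-smaller-bumps         []       y<z rewrite rowInsert-bump [] y<z = _ , refl , ≤-refl
rowInsert-smaller-bumps {y} {z} (a ∷ as) y<z with z <? a
... | yes z<a rewrite rowInsert-bump as z<a | rowInsert-bump as y<z = _ , refl , ≤-refl
... | no  z≮a rewrite rowInsert-pass as (≮⇒≥ z≮a) with y <? a
...   | yes y<a rewrite rowInsert-bump (proj₂ (rowInsert z as)) y<a = _ , refl , ≮⇒≥ z≮a
...   | no  y≮a rewrite rowInsert-pass (proj₂ (rowInsert z as)) (≮⇒≥ y≮a) =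
  rowInsert-smaller-bumps as y<z

-- The order on ℕ extended by nothing = +∞ (the letter was appended, not bumped).
_≤∞_ : Maybe ℕ → Maybe ℕ → Set
just c  ≤∞ just d  = c ≤ d
just _  ≤∞ nothing = ⊤
nothing ≤∞ just _  = ⊥
nothing ≤∞ nothing = ⊤

rowInsert-bumps-monotone : ∀ {y z} r → Sorted r → y ≤ z →
  proj₁ (rowInsert y r) ≤∞ proj₁ (rowInsert z (proj₂ (rowInsert y r)))
rowInsert-bumps-monotone         []       []           y≤z rewrite rowInsert-pass [] y≤z = tt
rowInsert-bumps-monotone {y} {z} (a ∷ as) (a≤as ∷ as↑) y≤z with y <? a
... | yes y<a rewrite rowInsert-bump as y<a | rowInsert-pass as y≤z
  with proj₁ (rowInsert z as) in bumped
...   | nothing = tt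
...   | just _  = proj₁ (rowInsert-bumped-bounds z as a≤as bumped)
rowInsert-bumps-monotone {y} {z} (a ∷ as) (a≤as ∷ as↑) y≤z | no y≮a
  rewrite rowInsert-pass as (≮⇒≥ y≮a)
        | rowInsert-pass (proj₂ (rowInsert y as)) (≤-trans (≮⇒≥ y≮a) y≤z)
  = rowInsert-bumps-monotone as as↑ y≤z

rowInsertWord : List ℕ → List ℕ → List ℕ × List ℕ
rowInsertWord []       r = [] , r
rowInsertWord (x ∷ xs) r =
  fromMaybe (proj₁ (rowInsert x r)) ++ proj₁ (rowInsertWord xs (proj₂ (rowInsert x r))) ,
  proj₂ (rowInsertWord xs (proj₂ (rowInsert x r)))

rowInsertWord-lowerBound : ∀ {a} as u → All (a ≤_) u →
  rowInsertWord u (a ∷ as) ≡ (proj₁ (rowInsertWord u as) , a ∷ proj₂ (rowInsertWord u as))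
rowInsertWord-lowerBound as []       []           = refl
rowInsertWord-lowerBound as (t ∷ ws) (a≤t ∷ a≤ws)
  rewrite rowInsert-pass as a≤t
        | rowInsertWord-lowerBound (proj₂ (rowInsert t as)) ws a≤ws = refl

insertWord : List ℕ → Tableau → Tableau
insertWord u T = foldl (λ T x → insert x T) T u

insertWord-∷ : ∀ u r rs →
  insertWord u (r ∷ rs) ≡ proj₂ (rowInsertWord u r) ∷ insertWord (proj₁ (rowInsertWord u r)) rs
insertWord-∷ []       r rs = refl
insertWord-∷ (x ∷ xs) r rs with rowInsert x r
... | nothing , r′ = insertWord-∷ xs r′ rs
... | just y  , r′ = insertWord-∷ xs r′ (insert y rs)

insert-sorted : ∀ x T → All Sorted T → All Sorted (insert x T)
insert-sorted x []       []         = ([] ∷ []) ∷ []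
insert-sorted x (r ∷ rs) (r↑ ∷ rs↑) with rowInsert x r | rowInsert-sorted x r↑
... | nothing , _ | r′↑ = r′↑ ∷ rs↑
... | just y  , _ | r′↑ = r′↑ ∷ insert-sorted y rs rs↑

insertWord-sorted : ∀ u T → All Sorted T → All Sorted (insertWord u T)
insertWord-sorted []       T T↑ = T↑
insertWord-sorted (x ∷ xs) T T↑ = insertWord-sorted xs (insert x T) (insert-sorted x T T↑)

data Knuth : List ℕ → List ℕ → Set where
  zxy↝xzy : ∀ {x y z} → x ≤ y → y < z → Knuth (z ∷ x ∷ y ∷ []) (x ∷ z ∷ y ∷ [])
  yzx↝yxz : ∀ {x y z} → x < y → y ≤ z → Knuth (y ∷ z ∷ x ∷ []) (y ∷ x ∷ z ∷ [])

_∼ₖ_ : List ℕ → List ℕ → Set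
_∼ₖ_ = EqClosure Knuth

_≈ᵣ_ : List ℕ × List ℕ → List ℕ × List ℕ → Set
(u , r) ≈ᵣ (v , s) = u ∼ₖ v × r ≡ s

rowInsertWord-empty-knuth : ∀ {u v} → Knuth u v → rowInsertWord u [] ≡ rowInsertWord v []
rowInsertWord-empty-knuth (zxy↝xzy {x} {y} {z} x≤y y<z)
  rewrite rowInsert-bump [] (≤-<-trans x≤y y<z) | rowInsert-pass [] x≤y
        | rowInsert-pass [] (≤-trans x≤y (<⇒≤ y<z)) | rowInsert-pass (z ∷ []) x≤y
        | rowInsert-bump [] y<z = refl
rowInsertWord-empty-knuth (yzx↝yxz {x} {y} {z} x<y y≤z)
  rewrite rowInsert-pass [] y≤z | rowInsert-bump (z ∷ []) x<y | rowInsert-bump [] x<y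
        | rowInsert-pass [] (≤-trans (<⇒≤ x<y) y≤z) = refl

insertWord-empty-knuth : ∀ {u v} → Knuth u v → insertWord u [] ≡ insertWord v []
insertWord-empty-knuth (zxy↝xzy {x} {y} {z} x≤y y<z)
  rewrite rowInsert-bump [] (≤-<-trans x≤y y<z) | rowInsert-pass [] x≤y
        | rowInsert-pass [] (≤-trans x≤y (<⇒≤ y<z)) | rowInsert-pass (z ∷ []) x≤y
        | rowInsert-bump [] y<z = refl
insertWord-empty-knuth (yzx↝yxz {x} {y} {z} x<y y≤z)
  rewrite rowInsert-pass [] y≤z | rowInsert-bump (z ∷ []) x<y | rowInsert-bump [] x<y
        | rowInsert-pass [] (≤-trans (<⇒≤ x<y) y≤z) = refl

rowInsertWord-below : ∀ {a} as {u v} → All (a ≤_) u → All (a ≤_) v →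
  rowInsertWord u as ≈ᵣ rowInsertWord v as → rowInsertWord u (a ∷ as) ≈ᵣ rowInsertWord v (a ∷ as)
rowInsertWord-below {a} as {u} {v} a≤u a≤v (u′∼v′ , r≡s)
  rewrite rowInsertWord-lowerBound as u a≤u | rowInsertWord-lowerBound as v a≤v =
  u′∼v′ , cong (a ∷_) r≡s

rowInsertWord-zxy↝xzy-between : ∀ {x y z a} as → x ≤ y → y < z → x < a → a ≤ z → All (a ≤_) as →
  rowInsertWord (z ∷ x ∷ y ∷ []) (a ∷ as) ≈ᵣ rowInsertWord (x ∷ z ∷ y ∷ []) (a ∷ as)
rowInsertWord-zxy↝xzy-between {x} {y} {z} {a} as x≤y y<z x<a a≤z a≤as
  rewrite rowInsert-bump as x<a | rowInsert-pass as a≤z | rowInsert-pass as (≤-trans x≤y (<⇒≤ y<z))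
        | rowInsert-bump (proj₂ (rowInsert z as)) x<a | rowInsert-pass (proj₂ (rowInsert z as)) x≤y
  with proj₁ (rowInsert z as) in z-bumps
... | nothing = ε , refl
... | just b with rowInsert-smaller-bumps as y<z
...   | c , y-bumps , c≤z rewrite y-bumps = return (fwd (zxy↝xzy a≤c c<b)) , refl
  where
  a≤c : a ≤ c
  a≤c = proj₁ (rowInsert-bumped-bounds y _ (rowInsert-lowerBound as a≤as a≤z) y-bumps)
  c<b : c < b
  c<b = ≤-<-trans c≤z (proj₂ (rowInsert-bumped-bounds z as a≤as z-bumps))

rowInsertWord-zxy↝xzy-above : ∀ {x y z a} as → x ≤ y → y < z → z < a → All (a ≤_) as →
  rowInsertWord (z ∷ x ∷ y ∷ []) (a ∷ as) ≈ᵣ rowInsertWord (x ∷ z ∷ y ∷ []) (a ∷ as)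
rowInsertWord-zxy↝xzy-above {x} {y} {z} {a} as x≤y y<z z<a a≤as
  rewrite rowInsert-bump as z<a | rowInsert-bump as (≤-<-trans x≤y y<z) | rowInsert-pass as x≤y
        | rowInsert-bump as (<-trans (≤-<-trans x≤y y<z) z<a)
        | rowInsert-pass as (≤-trans x≤y (<⇒≤ y<z)) | rowInsert-pass (proj₂ (rowInsert z as)) x≤y
  with as | a≤as
... | []     | [] rewrite rowInsert-bump [] y<z = ε , refl
... | b ∷ bs | a≤b ∷ _
  rewrite rowInsert-bump bs (<-≤-trans (<-trans y<z z<a) a≤b) | rowInsert-bump bs (<-≤-trans z<a a≤b)
        | rowInsert-bump bs y<z = return (bwd (yzx↝yxz z<a a≤b)) , refl

rowInsertWord-yzx↝yxz-between : ∀ {x y z a} as → x < y → y ≤ z → x < a → a ≤ y → Sorted as →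
  All (a ≤_) as → rowInsertWord (y ∷ z ∷ x ∷ []) (a ∷ as) ≈ᵣ rowInsertWord (y ∷ x ∷ z ∷ []) (a ∷ as)
rowInsertWord-yzx↝yxz-between {x} {y} {z} {a} as x<y y≤z x<a a≤y as↑ a≤as
  rewrite rowInsert-pass as a≤y | rowInsert-pass (proj₂ (rowInsert y as)) (≤-trans a≤y y≤z)
        | rowInsert-bump (proj₂ (rowInsert z (proj₂ (rowInsert y as)))) x<a
        | rowInsert-bump (proj₂ (rowInsert y as)) x<a
        | rowInsert-pass (proj₂ (rowInsert y as)) (≤-trans (<⇒≤ x<y) y≤z)
  with proj₁ (rowInsert y as) in y-bumps | proj₁ (rowInsert z (proj₂ (rowInsert y as)))
     | rowInsert-bumps-monotone as as↑ y≤z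
... | nothing | nothing | _   = ε , refl
... | nothing | just _  | ()
... | just _  | nothing | _   = ε , refl
... | just c  | just d  | c≤d = return (fwd (yzx↝yxz a<c c≤d)) , refl
  where
  a<c : a < c
  a<c = ≤-<-trans a≤y (proj₂ (rowInsert-bumped-bounds y as a≤as y-bumps))

rowInsertWord-yzx↝yxz-above : ∀ {x y z a} as → x < y → y ≤ z → y < a → All (a ≤_) as →
  rowInsertWord (y ∷ z ∷ x ∷ []) (a ∷ as) ≈ᵣ rowInsertWord (y ∷ x ∷ z ∷ []) (a ∷ as)
rowInsertWord-yzx↝yxz-above {x} {y} {z} {a} as x<y y≤z y<a a≤as
  rewrite rowInsert-bump as y<a | rowInsert-pass as y≤z | rowInsert-bump (proj₂ (rowInsert z as)) x<y
        | rowInsert-bump as x<y | rowInsert-pass as (≤-trans (<⇒≤ x<y) y≤z)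
  with proj₁ (rowInsert z as) in z-bumps
... | nothing = ε , refl
... | just d  = return (fwd (yzx↝yxz y<a (proj₁ (rowInsert-bumped-bounds z as a≤as z-bumps)))) , refl

rowInsertWord-knuth : ∀ r → Sorted r → ∀ {u v} → Knuth u v → rowInsertWord u r ≈ᵣ rowInsertWord v r
rowInsertWord-knuth [] [] k rewrite rowInsertWord-empty-knuth k = ε , refl
rowInsertWord-knuth (a ∷ as) (a≤as ∷ as↑) k@(zxy↝xzy {x} {y} {z} x≤y y<z) with x <? a | z <? a
... | no x≮a | _ = rowInsertWord-below as (a≤z ∷ a≤x ∷ a≤y ∷ []) (a≤x ∷ a≤z ∷ a≤y ∷ [])
                                         (rowInsertWord-knuth as as↑ k)
  where
  a≤x = ≮⇒≥ x≮a
  a≤y = ≤-trans a≤x x≤y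
  a≤z = ≤-trans a≤y (<⇒≤ y<z)
... | yes x<a | no z≮a = rowInsertWord-zxy↝xzy-between as x≤y y<z x<a (≮⇒≥ z≮a) a≤as
... | yes x<a | yes z<a = rowInsertWord-zxy↝xzy-above as x≤y y<z z<a a≤as
rowInsertWord-knuth (a ∷ as) (a≤as ∷ as↑) k@(yzx↝yxz {x} {y} {z} x<y y≤z) with x <? a | y <? a
... | no x≮a | _ = rowInsertWord-below as (a≤y ∷ a≤z ∷ a≤x ∷ []) (a≤y ∷ a≤x ∷ a≤z ∷ [])
                                         (rowInsertWord-knuth as as↑ k)
  where
  a≤x = ≮⇒≥ x≮a
  a≤y = ≤-trans a≤x (<⇒≤ x<y)
  a≤z = ≤-trans a≤y y≤z
... | yes x<a | no y≮a = rowInsertWord-yzx↝yxz-between as x<y y≤z x<a (≮⇒≥ y≮a) as↑ a≤as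
... | yes _   | yes y<a = rowInsertWord-yzx↝yxz-above as x<y y≤z y<a a≤as

insertWord-knuth : ∀ {T} → All Sorted T → ∀ {u v} → Knuth u v → insertWord u T ≡ insertWord v T
insertWord-knuth {[]}     []         k = insertWord-empty-knuth k
insertWord-knuth {r ∷ rs} (r↑ ∷ rs↑) {u} {v} k with rowInsertWord-knuth r r↑ k
... | bumped∼ , row≡ = begin
  insertWord u (r ∷ rs)                                            ≡⟨ insertWord-∷ u r rs ⟩
  proj₂ (rowInsertWord u r) ∷ insertWord (proj₁ (rowInsertWord u r)) rs
    ≡⟨ cong₂ _∷_ row≡ (gfold isEquivalence (λ w → insertWord w rs) (insertWord-knuth rs↑) bumped∼) ⟩
  proj₂ (rowInsertWord v r) ∷ insertWord (proj₁ (rowInsertWord v r)) rs ≡⟨ insertWord-∷ v r rs ⟨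
  insertWord v (r ∷ rs)                                            ∎
  where open ≡-Reasoning

insertionTableau-knuth : ∀ pre suf {u v} → Knuth u v →
  insertionTableau (pre ++ u ++ suf) ≡ insertionTableau (pre ++ v ++ suf)
insertionTableau-knuth pre suf {u} {v} k = begin
  insertWord (pre ++ u ++ suf) []            ≡⟨ foldl-++ _ [] pre (u ++ suf) ⟩
  insertWord (u ++ suf) (insertWord pre [])  ≡⟨ foldl-++ _ (insertWord pre []) u suf ⟩
  insertWord suf (insertWord u (insertWord pre []))
    ≡⟨ cong (insertWord suf) (insertWord-knuth (insertWord-sorted pre [] []) k) ⟩
  insertWord suf (insertWord v (insertWord pre []))  ≡⟨ foldl-++ _ (insertWord pre []) v suf ⟨
  insertWord (v ++ suf) (insertWord pre [])  ≡⟨ foldl-++ _ [] pre (v ++ suf) ⟨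
  insertWord (pre ++ v ++ suf) []            ∎
  where open ≡-Reasoning

tabulate-swap-adjacent : ∀ {A : Set} {n} (f g : Fin n → A) (d d₁ d₂ : Fin n) → Next d d₁ → Next d₁ d₂ →
  g d ≡ f d₁ → g d₁ ≡ f d → (∀ i → i ≢ d → i ≢ d₁ → g i ≡ f i) →
  ∃[ pre ] ∃[ suf ] tabulate f ≡ pre ++ f d ∷ f d₁ ∷ f d₂ ∷ suf
                  × tabulate g ≡ pre ++ f d₁ ∷ f d ∷ f d₂ ∷ suf
tabulate-swap-adjacent f g zero    zero          _                   ()
tabulate-swap-adjacent f g zero    (suc (suc _)) _                   ()
tabulate-swap-adjacent f g zero    (suc zero)    zero                _ ()
tabulate-swap-adjacent f g zero    (suc zero)    (suc zero)          _ ()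
tabulate-swap-adjacent f g zero    (suc zero)    (suc (suc (suc _))) _ ()
tabulate-swap-adjacent f g zero    (suc zero)    (suc (suc zero))    _ _ gd gd₁ elsewhere =
  [] , tabulate (λ i → f (suc (suc (suc i)))) , refl ,
  cong₂ _∷_ gd (cong₂ _∷_ gd₁ (cong₂ _∷_ (elsewhere _ (λ ()) (λ ()))
    (tabulate-cong (λ i → elsewhere (suc (suc (suc i))) (λ ()) (λ ())))))
tabulate-swap-adjacent f g (suc d) zero          _                   ()
tabulate-swap-adjacent f g (suc d) (suc d₁)      zero                _ ()
tabulate-swap-adjacent f g (suc d) (suc d₁)      (suc d₂)            d→d₁ d₁→d₂ gd gd₁ elsewhere
  with tabulate-swap-adjacent (λ i → f (suc i)) (λ i → g (suc i)) d d₁ d₂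
         (suc-injective d→d₁) (suc-injective d₁→d₂) gd gd₁
         (λ i i≢d i≢d₁ → elsewhere (suc i) (i≢d ∘ suc-injectiveᶠ) (i≢d₁ ∘ suc-injectiveᶠ))
... | pre , suf , f≡ , g≡ =
  f zero ∷ pre , suf , cong (f zero ∷_) f≡ , cong₂ _∷_ (elsewhere zero (λ ()) (λ ())) g≡

transpose-left : ∀ {n} (i j : Fin n) → PC.transpose i j i ≡ j
transpose-left i j rewrite dec-true (i ≟ᶠ i) refl = refl

transpose-right : ∀ {n} (i j : Fin n) → PC.transpose i j j ≡ i
transpose-right i j with i ≟ᶠ j
... | yes refl = transpose-left i i
... | no  i≢j rewrite dec-false (j ≟ᶠ i) (i≢j ∘ sym) | dec-true (j ≟ᶠ j) refl = refl

transpose-fixes : ∀ {n} (i j k : Fin n) → k ≢ i → k ≢ j → PC.transpose i j k ≡ k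
transpose-fixes i j k k≢i k≢j rewrite dec-false (k ≟ᶠ i) k≢i | dec-false (k ≟ᶠ j) k≢j = refl

oneLine-rightMulTransposition : ∀ {n} (w : Permutation′ n) (d d₁ d₂ : Fin n) → Next d d₁ → Next d₁ d₂ →
  ∃[ pre ] ∃[ suf ]
      oneLine w ≡ pre ++ toℕ (w ⟨$⟩ʳ d) ∷ toℕ (w ⟨$⟩ʳ d₁) ∷ toℕ (w ⟨$⟩ʳ d₂) ∷ suf
    × oneLine (rightMulTransposition w d d₁) ≡ pre ++ toℕ (w ⟨$⟩ʳ d₁) ∷ toℕ (w ⟨$⟩ʳ d) ∷ toℕ (w ⟨$⟩ʳ d₂) ∷ suf
oneLine-rightMulTransposition w d d₁ d₂ d→d₁ d₁→d₂
  with tabulate-swap-adjacent f g d d₁ d₂ d→d₁ d₁→d₂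
         (cong f (transpose-left d d₁)) (cong f (transpose-right d d₁))
         (λ i i≢d i≢d₁ → cong f (transpose-fixes d d₁ i i≢d i≢d₁))
  where
  f g : Fin _ → ℕ
  f i = toℕ (w ⟨$⟩ʳ i)
  g i = toℕ (rightMulTransposition w d d₁ ⟨$⟩ʳ i)
... | pre , suf , f≡ , g≡ = pre , suf , trans (map-tabulate id _) f≡ , trans (map-tabulate id _) g≡

lemma5p4 : ∀ {n : ℕ} (w : Permutation′ n) (d d₁ d₂ : Fin n)
    → FullyCommutative w
    → Next d d₁
    → Next d₁ d₂
    → (w ⟨$⟩ʳ d₁) Fin.< (w ⟨$⟩ʳ d)
    → (w ⟨$⟩ʳ d₂) Fin.< (w ⟨$⟩ʳ d)
    → P w ≡ P (rightMulTransposition w d d₁)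
lemma5p4 w d d₁ d₂ w-avoids-321 d→d₁ d₁→d₂ b<a c<a
  with pre , suf , w≡ , ws≡ ← oneLine-rightMulTransposition w d d₁ d₂ d→d₁ d₁→d₂ =
  trans (cong insertionTableau w≡)
    (trans (insertionTableau-knuth pre suf (zxy↝xzy b≤c c<a)) (sym (cong insertionTableau ws≡)))
  where
  b≤c : toℕ (w ⟨$⟩ʳ d₁) ≤ toℕ (w ⟨$⟩ʳ d₂)
  b≤c = ≮⇒≥ λ c<b →
    w-avoids-321 (d , d₁ , d₂ , ≤-reflexive (sym d→d₁) , ≤-reflexive (sym d₁→d₂) , b<a , c<b)
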